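{- Let $k\ge1$, let $U=\sum_{i=0}^\infty x^{ -i}\in\mathbb{F}_2((x^{ -1}))$, and let $Q\in\mathbb{F}_2[x]$ be a nonzero polynomial. Write $$QU^{2^k}=\sum_{i=-\deg Q}^{\infty} b_i x^{ -i},\qquad b_i\in\mathbb{F}_2.$$ Then $b_i=b_j$ for all $i,j\ge0$ with $i\equiv j\pmod{2^k}$, and $$Q\equiv b_1x^{2^k-1}+b_2x^{2^k-2}+\dots+b_{2^k}\pmod{x^{2^k}+1}.$$
   Context: $\mathbb{F}_2((x^{ -1}))$ denotes the field of formal Laurent series $\sum_{i=-m}^\infty r_ix^{ -i}$ with $r_i\in\mathbb{F}_2$, containing $\mathbb{F}_2[x]$. -}

module Defs where

open import Data.Bool using (Bool; true; false; _xor_; _∧_; if_then_else_)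
open import Data.Nat using (ℕ; zero; suc; _+_; _∸_; _^_)
open import Data.Nat.Properties using (m^n≢0)
open import Data.Nat.DivMod using (_%_)
open import Data.List using (List; []; _∷_; map; foldr; upTo; length; replicate; _++_)
open import Data.Product using (Σ; ∃)
open import Relation.Binary.PropositionalEquality using (_≡_)

⨁ : List Bool → Bool
⨁ = foldr _xor_ false

-- Polynomials over F₂: coefficient lists, lowest degree first.
-- (trailing zeros allowed; equality is coefficientwise)

Poly : Set
Poly = List Bool

coeff : Poly → ℕ → Bool
coeff []       _       = false
coeff (a ∷ p)  zero    = a
coeff (a ∷ p)  (suc n) = coeff p n

_+ₚ_ : Poly → Poly → Poly
[]      +ₚ q       = q
(a ∷ p) +ₚ []      = a ∷ p
(a ∷ p) +ₚ (b ∷ q) = (a xor b) ∷ (p +ₚ q)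

_*ₚ_ : Poly → Poly → Poly
[]      *ₚ q = []
(a ∷ p) *ₚ q = (if a then q else []) +ₚ (false ∷ (p *ₚ q))

_≈ₚ_ : Poly → Poly → Set
P ≈ₚ R = ∀ n → coeff P n ≡ coeff R n

NonZeroPoly : Poly → Set
NonZeroPoly Q = ∃ λ n → coeff Q n ≡ true

-- P ≡ R (mod M) in F₂[x]:  M divides P - R = P + R
_≡_mod_ : Poly → Poly → Poly → Set
P ≡ R mod M = Σ Poly λ C → (P +ₚ R) ≈ₚ (C *ₚ M)

X^ : ℕ → Poly
X^ n = replicate n false ++ (true ∷ [])

-- Power series in x⁻¹ over F₂:  S i = coefficient of x^{-i}  (i ≥ 0).
-- These form a subring of F₂((x⁻¹)).

Series : Set
Series = ℕ → Bool

_*ₛ_ : Series → Series → Series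
(A *ₛ B) n = ⨁ (map (λ i → A i ∧ B (n ∸ i)) (upTo (suc n)))

oneₛ : Series
oneₛ zero    = true
oneₛ (suc _) = false

_^ₛ_ : Series → ℕ → Series
S ^ₛ zero  = oneₛ
S ^ₛ suc n = S *ₛ (S ^ₛ n)

U : Series
U _ = true

-- Product of a polynomial Q = Σ_j q_j x^j with a series S = Σ_i s_i x^{-i}
-- in F₂((x⁻¹)); `polyTimesSeries Q S i` is the coefficient of x^{-i}
-- for i ≥ 0, namely Σ_j q_j s_{i+j}.
polyTimesSeries : Poly → Series → ℕ → Bool
polyTimesSeries Q S i = ⨁ (map (λ j → coeff Q j ∧ S (i + j)) (upTo (length Q)))

_≡_mod2^_ : ℕ → ℕ → ℕ → Set
i ≡ j mod2^ k = _%_ i (2 ^ k) {{m^n≢0 2 k}} ≡ _%_ j (2 ^ k) {{m^n≢0 2 k}}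

-- b₁ x^{N-1} + b₂ x^{N-2} + … + b_N  (coefficient of x^t is b_{N-t}, 0 ≤ t < N)
reversedPoly : (ℕ → Bool) → ℕ → Poly
reversedPoly b N = map (λ t → b (N ∸ t)) (upTo N)

module Submission where

-- Write N = 2^k and V = U^N.  Over F₂ we have U = 1/(1 + x⁻¹), and the
-- Frobenius identity (1 + y)² = 1 + y² gives (1 + x⁻¹)^N = 1 + x^{-N}, so
--   V = 1/(1 + x^{-N}) = Σ_m x^{-Nm},
-- the series whose coefficient of x^{-n} is 1 exactly when N divides n.
--
-- Next, elementary
-- facts about the coefficients b_i = Σ_j q_j V(i + j) of Q·V: they inherit the
-- period N (first claim), and they satisfy a one-step recursion in Q.  Finally,
-- for R(Q) = Σ_{t<N} b_{N-t} x^t, that recursion shows by induction on Q that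
-- Q + R(Q) = C(Q)·(x^N + 1) for an explicit cofactor C(Q) (second claim).

open import Defs
open import Data.Nat using (ℕ; zero; suc; _+_; _*_; _∸_; _^_; _≤_; _<_; s≤s; z≤n; NonZero; _%_; _/_)
open import Data.Nat.Properties
  using (_<?_; <-cmp; ≤-refl; <⇒≤; <⇒≢; ≮⇒≥; m<n⇒m<1+n; suc-injective; +-assoc; +-comm; +-suc; +-identityʳ;
         +-cancelˡ-<; +-∸-assoc; m+[n∸m]≡n; m+n∸n≡m; m∸n≤m; m<n⇒0<n∸m; m^n>0; m^n≢0)
open import Data.Nat.DivMod using (m≡m%n+[m/n]*n; %-distribˡ-+)
open import Data.Bool using (Bool; true; false; _xor_; _∧_; if_then_else_)
open import Data.Bool.Properties using (xor-comm; xor-assoc; xor-identityʳ; xor-same; ∧-zeroʳ; ∧-identityʳ)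
open import Data.List using ([]; _∷_; map; applyUpTo; upTo; length)
open import Data.List.Properties using (map-applyUpTo; map-cong; map-∘)
open import Data.Product using (Σ; _×_; _,_)
open import Data.Sum using (_⊎_; inj₁; inj₂)
open import Data.Empty using (⊥-elim)
open import Function using (_∘_; id)
open import Relation.Binary using (tri<; tri≈; tri>)
open import Relation.Nullary using (yes; no)
open import Relation.Binary.PropositionalEquality
open ≡-Reasoning

xor-cancelˡ : ∀ a c → a xor (a xor c) ≡ c
xor-cancelˡ true  true  = refl
xor-cancelˡ true  false = refl
xor-cancelˡ false c     = refl

xor-rotate : ∀ a b c → a xor (b xor c) ≡ c xor (a xor b)
xor-rotate a b c = trans (sym (xor-assoc a b c)) (xor-comm (a xor b) c)

xor-∧-false : ∀ x c → x ≡ x xor (c ∧ false)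
xor-∧-false x c = sym (trans (cong (x xor_) (∧-zeroʳ c)) (xor-identityʳ x))

xor-telescope : ∀ a b c → (a xor b) xor (b xor c) ≡ a xor c
xor-telescope a     false c     = cong (_xor c) (xor-identityʳ a)
xor-telescope true  true  c     = refl
xor-telescope false true  true  = refl
xor-telescope false true  false = refl

-- `IsQuotientBy d S X` says X·(1 + x^{-d}) = S in F₂[[x⁻¹]]: the first d
-- coefficients agree, and afterwards X(d + n) = X(n) + S(d + n).
IsQuotientBy : ℕ → Series → Series → Set
IsQuotientBy d S X = (∀ n → n < d → X n ≡ S n) × (∀ n → X (d + n) ≡ X n xor S (d + n))

U*-prefixSum : ∀ S n → (U *ₛ S) n ≡ ⨁ (applyUpTo (λ i → S (n ∸ i)) (suc n))
U*-prefixSum S n = cong ⨁ (map-applyUpTo id (λ i → true ∧ S (n ∸ i)) (suc n))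

U*-quotient : ∀ S → IsQuotientBy 1 S (U *ₛ S)
U*-quotient S = initial , step
  where
  initial : ∀ n → n < 1 → (U *ₛ S) n ≡ S n
  initial zero    _             = trans (U*-prefixSum S 0) (xor-identityʳ (S 0))
  initial (suc n) (s≤s ())
  step : ∀ n → (U *ₛ S) (suc n) ≡ (U *ₛ S) n xor S (suc n)
  step n = begin
    (U *ₛ S) (suc n)                  ≡⟨ U*-prefixSum S (suc n) ⟩
    S (suc n) xor ⨁ (applyUpTo (λ i → S (n ∸ i)) (suc n)) ≡⟨ cong (S (suc n) xor_) (sym (U*-prefixSum S n)) ⟩
    S (suc n) xor (U *ₛ S) n          ≡⟨ xor-comm (S (suc n)) _ ⟩
    (U *ₛ S) n xor S (suc n)          ∎

below-double : ∀ d n → n < d + d → n < d ⊎ Σ ℕ (λ m → m < d × d + m ≡ n)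
below-double d n n<2d with n <? d
... | yes n<d = inj₁ n<d
... | no n≮d  = inj₂ (n ∸ d , m<d , d+m≡n)
  where
  d+m≡n : d + (n ∸ d) ≡ n
  d+m≡n = m+[n∸m]≡n (≮⇒≥ n≮d)
  m<d : n ∸ d < d
  m<d = +-cancelˡ-< d (n ∸ d) d (subst (_< d + d) (sym d+m≡n) n<2d)

-- Frobenius step: dividing twice by 1 + x^{-d} is dividing by
-- (1 + x^{-d})² = 1 + x^{-2d}.
quotient-twice : ∀ d X Y Z → IsQuotientBy d Y X → IsQuotientBy d Z Y → IsQuotientBy (d + d) Z X
quotient-twice d X Y Z (initialX , stepX) (initialY , stepY) = initial , step
  where
  upper : ∀ m → m < d → X (d + m) ≡ Z (d + m)
  upper m m<d = begin
    X (d + m)                   ≡⟨ stepX m ⟩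
    X m xor Y (d + m)           ≡⟨ cong₂ _xor_ (initialX m m<d) (stepY m) ⟩
    Y m xor (Y m xor Z (d + m)) ≡⟨ xor-cancelˡ (Y m) _ ⟩
    Z (d + m)                   ∎
  initial : ∀ n → n < d + d → X n ≡ Z n
  initial n n<2d with below-double d n n<2d
  ... | inj₁ n<d              = trans (initialX n n<d) (initialY n n<d)
  ... | inj₂ (m , m<d , refl) = upper m m<d
  step : ∀ n → X ((d + d) + n) ≡ X n xor Z ((d + d) + n)
  step n = begin
    X ((d + d) + n)                       ≡⟨ cong X (+-assoc d d n) ⟩
    X (d + (d + n))                       ≡⟨ stepX (d + n) ⟩
    X (d + n) xor Y (d + (d + n))         ≡⟨ cong₂ _xor_ (stepX n) (stepY (d + n)) ⟩
    (X n xor Y (d + n)) xor (Y (d + n) xor Z (d + (d + n))) ≡⟨ xor-telescope (X n) _ _ ⟩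
    X n xor Z (d + (d + n))               ≡⟨ cong (λ t → X n xor Z t) (sym (+-assoc d d n)) ⟩
    X n xor Z ((d + d) + n)               ∎

mulU : ℕ → Series → Series
mulU zero    S = S
mulU (suc m) S = U *ₛ mulU m S

mulU-+ : ∀ a b S → mulU (a + b) S ≡ mulU a (mulU b S)
mulU-+ zero    b S = refl
mulU-+ (suc a) b S = cong (U *ₛ_) (mulU-+ a b S)

mulU-2^k-quotient : ∀ k S → IsQuotientBy (2 ^ k) S (mulU (2 ^ k) S)
mulU-2^k-quotient zero    S = U*-quotient S
mulU-2^k-quotient (suc k) S =
  subst (λ m → IsQuotientBy m S (mulU m S)) d+d≡2^[1+k]
    (subst (IsQuotientBy (d + d) S) (sym (mulU-+ d d S))
      (quotient-twice d _ _ S (mulU-2^k-quotient k (mulU d S)) (mulU-2^k-quotient k S)))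
  where
  d : ℕ
  d = 2 ^ k
  d+d≡2^[1+k] : d + d ≡ 2 ^ suc k
  d+d≡2^[1+k] = cong (d +_) (sym (+-identityʳ d))

U^-mulU : ∀ m → U ^ₛ m ≡ mulU m oneₛ
U^-mulU zero    = refl
U^-mulU (suc m) = cong (U *ₛ_) (U^-mulU m)

U^2^k-quotient : ∀ k → IsQuotientBy (2 ^ k) oneₛ (U ^ₛ (2 ^ k))
U^2^k-quotient k = subst (IsQuotientBy (2 ^ k) oneₛ) (sym (U^-mulU (2 ^ k))) (mulU-2^k-quotient k oneₛ)

Periodic : ℕ → Series → Set
Periodic N V = ∀ n → V (N + n) ≡ V n

inverse-periodic : ∀ N V → 1 ≤ N → IsQuotientBy N oneₛ V → Periodic N V
inverse-periodic (suc N) V _ (_ , step) n = trans (step n) (xor-identityʳ (V n))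

inverse-gap : ∀ N V → IsQuotientBy N oneₛ V → ∀ t → 0 < t → t < N → V t ≡ false
inverse-gap N V (initial , _) (suc t) _ t<N = initial (suc t) t<N

inverse-at-N : ∀ N V → 1 ≤ N → IsQuotientBy N oneₛ V → V N ≡ true
inverse-at-N N V 1≤N quot@(initial , _) = begin
  V N       ≡⟨ cong V (sym (+-identityʳ N)) ⟩
  V (N + 0) ≡⟨ inverse-periodic N V 1≤N quot 0 ⟩
  V 0       ≡⟨ initial 0 1≤N ⟩
  true      ∎

polyTimesSeries-cong : ∀ Q S T i i′ → (∀ j → S (i + j) ≡ T (i′ + j)) →
  polyTimesSeries Q S i ≡ polyTimesSeries Q T i′
polyTimesSeries-cong Q S T i i′ eq =
  cong ⨁ (map-cong (λ j → cong (coeff Q j ∧_) (eq j)) (upTo (length Q)))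

polyTimesSeries-∷ : ∀ a Q S i →
  polyTimesSeries (a ∷ Q) S i ≡ (a ∧ S i) xor polyTimesSeries Q S (suc i)
polyTimesSeries-∷ a Q S i =
  cong₂ _xor_ (cong (λ t → a ∧ S t) (+-identityʳ i)) (cong ⨁ tail-terms)
  where
  term : ℕ → Bool
  term j = coeff (a ∷ Q) j ∧ S (i + j)
  tail-terms : map term (applyUpTo suc (length Q))
             ≡ map (λ j → coeff Q j ∧ S (suc i + j)) (upTo (length Q))
  tail-terms = begin
    map term (applyUpTo suc (length Q))  ≡⟨ cong (map term) (sym (map-applyUpTo id suc (length Q))) ⟩
    map term (map suc (upTo (length Q))) ≡⟨ sym (map-∘ (upTo (length Q))) ⟩
    map (term ∘ suc) (upTo (length Q))   ≡⟨ map-cong (λ j → cong (λ t → coeff Q j ∧ S t) (+-suc i j)) _ ⟩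
    map (λ j → coeff Q j ∧ S (suc i + j)) (upTo (length Q)) ∎

periodic-mod : ∀ N .{{_ : NonZero N}} V → Periodic N V → ∀ m → V m ≡ V (m % N)
periodic-mod N V per m = trans (cong V (m≡m%n+[m/n]*n m N)) (drop-multiple (m % N) (m / N))
  where
  drop-multiple : ∀ r q → V (r + q * N) ≡ V r
  drop-multiple r zero    = cong V (+-identityʳ r)
  drop-multiple r (suc q) = begin
    V (r + (N + q * N)) ≡⟨ cong V (+-comm r (N + q * N)) ⟩
    V (N + q * N + r)   ≡⟨ cong V (+-assoc N (q * N) r) ⟩
    V (N + (q * N + r)) ≡⟨ per (q * N + r) ⟩
    V (q * N + r)       ≡⟨ cong V (+-comm (q * N) r) ⟩
    V (r + q * N)       ≡⟨ drop-multiple r q ⟩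
    V r                 ∎

polyTimesSeries-mod : ∀ N .{{_ : NonZero N}} V → Periodic N V → ∀ Q i j →
  i % N ≡ j % N → polyTimesSeries Q V i ≡ polyTimesSeries Q V j
polyTimesSeries-mod N V per Q i j i≡j = polyTimesSeries-cong Q V V i j shifted
  where
  shifted : ∀ t → V (i + t) ≡ V (j + t)
  shifted t = begin
    V (i + t)              ≡⟨ periodic-mod N V per (i + t) ⟩
    V ((i + t) % N)        ≡⟨ cong V (%-distribˡ-+ i t N) ⟩
    V ((i % N + t % N) % N) ≡⟨ cong (λ r → V ((r + t % N) % N)) i≡j ⟩
    V ((j % N + t % N) % N) ≡⟨ cong V (sym (%-distribˡ-+ j t N)) ⟩
    V ((j + t) % N)        ≡⟨ sym (periodic-mod N V per (j + t)) ⟩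
    V (j + t)              ∎

coeff-+ₚ : ∀ p q n → coeff (p +ₚ q) n ≡ coeff p n xor coeff q n
coeff-+ₚ []      q       n       = refl
coeff-+ₚ (a ∷ p) []      n       = sym (xor-identityʳ _)
coeff-+ₚ (a ∷ p) (b ∷ q) zero    = refl
coeff-+ₚ (a ∷ p) (b ∷ q) (suc n) = coeff-+ₚ p q n

coeff-*ₚ-∷ : ∀ c C M n → coeff ((c ∷ C) *ₚ M) n ≡ (c ∧ coeff M n) xor coeff (false ∷ (C *ₚ M)) n
coeff-*ₚ-∷ c C M n = trans (coeff-+ₚ (if c then M else []) _ n) (cong (_xor _) (scale c))
  where
  scale : ∀ c → coeff (if c then M else []) n ≡ c ∧ coeff M n
  scale true  = refl
  scale false = refl

coeff-X^-self : ∀ N → coeff (X^ N) N ≡ true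
coeff-X^-self zero    = refl
coeff-X^-self (suc N) = coeff-X^-self N

coeff-X^-other : ∀ N m → m ≢ N → coeff (X^ N) m ≡ false
coeff-X^-other zero    zero    m≢N = ⊥-elim (m≢N refl)
coeff-X^-other zero    (suc m) _   = refl
coeff-X^-other (suc N) zero    _   = refl
coeff-X^-other (suc N) (suc m) m≢N = coeff-X^-other N m (m≢N ∘ cong suc)

coeff-tabulate-< : ∀ (f : ℕ → Bool) N t → t < N → coeff (map f (upTo N)) t ≡ f t
coeff-tabulate-< f N t t<N = trans (cong (λ p → coeff p t) (map-applyUpTo id f N)) (go f N t t<N)
  where
  go : ∀ (f : ℕ → Bool) N t → t < N → coeff (applyUpTo f N) t ≡ f t
  go f (suc N) zero    _         = refl
  go f (suc N) (suc t) (s≤s t<N) = go (f ∘ suc) N t t<N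

coeff-tabulate-≥ : ∀ (f : ℕ → Bool) N t → N ≤ t → coeff (map f (upTo N)) t ≡ false
coeff-tabulate-≥ f N t N≤t = trans (cong (λ p → coeff p t) (map-applyUpTo id f N)) (go f N t N≤t)
  where
  go : ∀ (f : ℕ → Bool) N t → N ≤ t → coeff (applyUpTo f N) t ≡ false
  go f zero    t       _         = refl
  go f (suc N) (suc t) (s≤s N≤t) = go (f ∘ suc) N t N≤t

-- Constant term of (a + x·Q) + R(a + x·Q) versus that of (c + x·C)·(x^N + 1).
constant-term : ∀ a c → a xor ((a xor c) xor (c ∧ false)) ≡ (c ∧ (false xor true)) xor false
constant-term true  true  = refl
constant-term true  false = refl
constant-term false true  = refl
constant-term false false = refl

module Reduction (N′ : ℕ) (V : Series) (V-inverse : IsQuotientBy (suc N′) oneₛ V) where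

  N : ℕ
  N = suc N′

  M : Poly
  M = X^ N +ₚ X^ 0

  b : Poly → ℕ → Bool
  b Q = polyTimesSeries Q V

  R : Poly → Poly
  R Q = reversedPoly (b Q) N

  C : Poly → Poly
  C []      = []
  C (a ∷ Q) = b Q 1 ∷ C Q

  -- By N-periodicity of V, b_Q(N + 1) = b_Q(1).
  b-wraps : ∀ Q → b Q (suc N) ≡ b Q 1
  b-wraps Q = polyTimesSeries-cong Q V V (suc N) 1
    (λ j → trans (cong V (sym (+-suc N j))) (inverse-periodic N V (s≤s z≤n) V-inverse (suc j)))

  R-coeff-< : ∀ Q t → t < N → coeff (R Q) t ≡ b Q (N ∸ t)
  R-coeff-< Q = coeff-tabulate-< (λ t → b Q (N ∸ t)) N

  R-coeff-≥ : ∀ Q t → N ≤ t → coeff (R Q) t ≡ false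
  R-coeff-≥ Q = coeff-tabulate-≥ (λ t → b Q (N ∸ t)) N

  R-[] : ∀ t → coeff (R []) t ≡ false
  R-[] t with t <? N
  ... | yes t<N = R-coeff-< [] t t<N
  ... | no  t≮N = R-coeff-≥ [] t (≮⇒≥ t≮N)

  -- R(a + x·Q) = (a + c) + x·R(Q) + c·x^N  with c = b_Q(1): multiplying by x
  -- shifts the reversed coefficients up by one, and the top one wraps around.
  R-∷ : ∀ a Q n → coeff (R (a ∷ Q)) n ≡ coeff ((a xor b Q 1) ∷ R Q) n xor (b Q 1 ∧ coeff (X^ N) n)
  R-∷ a Q zero = begin
    coeff (R (a ∷ Q)) 0             ≡⟨ R-coeff-< (a ∷ Q) 0 (s≤s z≤n) ⟩
    b (a ∷ Q) N                     ≡⟨ polyTimesSeries-∷ a Q V N ⟩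
    (a ∧ V N) xor b Q (suc N)       ≡⟨ cong₂ (λ v w → (a ∧ v) xor w) (inverse-at-N N V (s≤s z≤n) V-inverse) (b-wraps Q) ⟩
    (a ∧ true) xor b Q 1            ≡⟨ cong (_xor b Q 1) (∧-identityʳ a) ⟩
    a xor b Q 1                     ≡⟨ xor-∧-false (a xor b Q 1) (b Q 1) ⟩
    (a xor b Q 1) xor (b Q 1 ∧ false) ∎
  R-∷ a Q (suc m) with <-cmp m N′
  ... | tri< m<N′ _ _ = begin
    coeff (R (a ∷ Q)) (suc m)             ≡⟨ R-coeff-< (a ∷ Q) (suc m) (s≤s m<N′) ⟩
    b (a ∷ Q) (N′ ∸ m)                    ≡⟨ polyTimesSeries-∷ a Q V (N′ ∸ m) ⟩
    (a ∧ V (N′ ∸ m)) xor b Q (suc (N′ ∸ m)) ≡⟨ cong₂ (λ v w → (a ∧ v) xor b Q w) gap (sym (+-∸-assoc 1 (<⇒≤ m<N′))) ⟩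
    (a ∧ false) xor b Q (N ∸ m)           ≡⟨ cong (_xor b Q (N ∸ m)) (∧-zeroʳ a) ⟩
    b Q (N ∸ m)                           ≡⟨ sym (R-coeff-< Q m (m<n⇒m<1+n m<N′)) ⟩
    coeff (R Q) m                         ≡⟨ xor-∧-false (coeff (R Q) m) (b Q 1) ⟩
    coeff (R Q) m xor (b Q 1 ∧ false)     ≡⟨ cong (λ x → coeff (R Q) m xor (b Q 1 ∧ x)) (sym (coeff-X^-other N (suc m) (<⇒≢ (s≤s m<N′)))) ⟩
    coeff (R Q) m xor (b Q 1 ∧ coeff (X^ N) (suc m)) ∎
    where
    gap : V (N′ ∸ m) ≡ false
    gap = inverse-gap N V V-inverse (N′ ∸ m) (m<n⇒0<n∸m m<N′) (s≤s (m∸n≤m N′ m))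
  ... | tri≈ _ refl _ = begin
    coeff (R (a ∷ Q)) N                   ≡⟨ R-coeff-≥ (a ∷ Q) N ≤-refl ⟩
    false                                 ≡⟨ sym (xor-same (b Q 1)) ⟩
    b Q 1 xor b Q 1                       ≡⟨ cong₂ _xor_ (cong (b Q) (sym (m+n∸n≡m 1 m))) (sym (∧-identityʳ (b Q 1))) ⟩
    b Q (N ∸ m) xor (b Q 1 ∧ true)        ≡⟨ cong₂ (λ r x → r xor (b Q 1 ∧ x)) (sym (R-coeff-< Q m ≤-refl)) (sym (coeff-X^-self N)) ⟩
    coeff (R Q) m xor (b Q 1 ∧ coeff (X^ N) N) ∎
  ... | tri> _ m≢N′ N′<m = begin
    coeff (R (a ∷ Q)) (suc m)             ≡⟨ R-coeff-≥ (a ∷ Q) (suc m) (s≤s (<⇒≤ N′<m)) ⟩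
    false                                 ≡⟨ xor-∧-false false (b Q 1) ⟩
    false xor (b Q 1 ∧ false)             ≡⟨ cong₂ (λ r x → r xor (b Q 1 ∧ x)) (sym (R-coeff-≥ Q m N′<m)) (sym (coeff-X^-other N (suc m) (m≢N′ ∘ suc-injective))) ⟩
    coeff (R Q) m xor (b Q 1 ∧ coeff (X^ N) (suc m)) ∎

  reduction : ∀ Q n → coeff (Q +ₚ R Q) n ≡ coeff (C Q *ₚ M) n
  reduction []      n = R-[] n
  reduction (a ∷ Q) n = begin
    coeff ((a ∷ Q) +ₚ R (a ∷ Q)) n        ≡⟨ coeff-+ₚ (a ∷ Q) (R (a ∷ Q)) n ⟩
    coeff (a ∷ Q) n xor coeff (R (a ∷ Q)) n ≡⟨ cong (coeff (a ∷ Q) n xor_) (R-∷ a Q n) ⟩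
    coeff (a ∷ Q) n xor (coeff (c′ ∷ R Q) n xor (c ∧ coeff (X^ N) n)) ≡⟨ shifted n ⟩
    (c ∧ coeff M n) xor coeff (false ∷ (C Q *ₚ M)) n ≡⟨ sym (coeff-*ₚ-∷ c (C Q) M n) ⟩
    coeff (C (a ∷ Q) *ₚ M) n ∎
    where
    c c′ : Bool
    c  = b Q 1
    c′ = a xor c
    shifted : ∀ n → coeff (a ∷ Q) n xor (coeff (c′ ∷ R Q) n xor (c ∧ coeff (X^ N) n))
                  ≡ (c ∧ coeff M n) xor coeff (false ∷ (C Q *ₚ M)) n
    shifted zero    = constant-term a c
    shifted (suc m) = begin
      coeff Q m xor (coeff (R Q) m xor (c ∧ x)) ≡⟨ xor-rotate (coeff Q m) (coeff (R Q) m) (c ∧ x) ⟩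
      (c ∧ x) xor (coeff Q m xor coeff (R Q) m) ≡⟨ cong₂ (λ y z → (c ∧ y) xor z) (sym (xor-identityʳ x)) (sym (coeff-+ₚ Q (R Q) m)) ⟩
      (c ∧ (x xor false)) xor coeff (Q +ₚ R Q) m ≡⟨ cong₂ (λ y z → (c ∧ y) xor z) (sym (coeff-+ₚ (X^ N) (X^ 0) (suc m))) (reduction Q m) ⟩
      (c ∧ coeff M (suc m)) xor coeff (C Q *ₚ M) m ∎
      where
      x : Bool
      x = coeff (X^ N) (suc m)

  congruence : ∀ Q → Q ≡ R Q mod M
  congruence Q = C Q , reduction Q

mod-reduction : ∀ N V → 1 ≤ N → IsQuotientBy N oneₛ V → ∀ Q →
  Q ≡ reversedPoly (polyTimesSeries Q V) N mod (X^ N +ₚ X^ 0)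
mod-reduction (suc N′) V _ V-inverse = Reduction.congruence N′ V V-inverse

lemma2 : (k : ℕ) → 1 ≤ k → (Q : Poly) → NonZeroPoly Q →
    (∀ i j → i ≡ j mod2^ k →
      polyTimesSeries Q (U ^ₛ (2 ^ k)) i ≡ polyTimesSeries Q (U ^ₛ (2 ^ k)) j)
    × (Q ≡ reversedPoly (polyTimesSeries Q (U ^ₛ (2 ^ k))) (2 ^ k)
         mod (X^ (2 ^ k) +ₚ X^ 0))
lemma2 k _ Q _ =
    polyTimesSeries-mod N {{m^n≢0 2 k}} V (inverse-periodic N V 1≤N V-inverse) Q
  , mod-reduction N V 1≤N V-inverse Q
  where
  N : ℕ
  N = 2 ^ k
  V : Series
  V = U ^ₛ N
  1≤N : 1 ≤ N
  1≤N = m^n>0 2 k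
  V-inverse : IsQuotientBy N oneₛ V
  V-inverse = U^2^k-quotient k
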